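{- Let $T$ be a decomposition tree and $v$ an internal node of $T$ labeled $\otimes$, with left child $v_l$ and right child $v_r$. Then $\hat\gamma_0(v)=\min\{\hat\gamma_i(v_l)+\hat\gamma_i(v_r): 0\le i\le \min\{|\hat{TS}(v_l)|,|\hat{TS}(v_r)|\}\}$.
   Context: All graphs are finite, simple and undirected. For a graph $H$ and $S\subseteq V(H)$, $N_H[S]$ is the closed neighbourhood of $S$ in $H$ and $H[S]$ the induced subgraph; a graph with no vertices is regarded as having a (empty) perfect matching. A decomposition tree is a rooted tree $T$ in which every internal node has exactly two children, a left child $v_l$ and a right child $v_r$, and carries one of the labels $\otimes$ (true twin), $\odot$ (false twin), $\oplus$ (attachment). To each node $v$ are associated a graph $\hat G(v)$ and a twin set $\hat{TS}(v)\subseteq V(\hat G(v))$: for a leaf, $\hat G(v)$ is a single vertex $x$ (distinct leaves giving distinct vertices) and $\hat{TS}(v)=\{x\}$; for an internal node $v$, $V(\hat G(v))=V(\hat G(v_l))\cup V(\hat G(v_r))$ and: if $v$ is labeled $\otimes$, $E(\hat G(v))=E(\hat G(v_l))\cup E(\hat G(v_r))\cup\{xy: x\in \hat{TS}(v_l), y\in\hat{TS}(v_r)\}$ and $\hat{TS}(v)=\hat{TS}(v_l)\cup\hat{TS}(v_r)$; if labeled $\odot$, $E(\hat G(v))=E(\hat G(v_l))\cup E(\hat G(v_r))$ and $\hat{TS}(v)=\hat{TS}(v_l)\cup\hat{TS}(v_r)$; if labeled $\oplus$, the edge set is as for $\otimes$ and $\hat{TS}(v)=\hat{TS}(v_l)$.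 For a node $u$ and $0\le k\le|\hat{TS}(u)|$, $\hat\gamma_k(u)$ is the minimum of $|S|$ over all $S\subseteq V(\hat G(u))$ with $V(\hat G(u))\setminus \hat{TS}(u)\subseteq N_{\hat G(u)}[S]$ for which there is $X\subseteq S\cap\hat{TS}(u)$, $|X|=k$, such that $\hat G(u)[S\setminus X]$ has a perfect matching. -}

module Defs where

open import Data.Bool using (Bool; true; false; _∧_; not; T; if_then_else_)
open import Data.Nat using (ℕ; zero; suc; _+_; _≤_; _⊓_)
open import Data.Product using (Σ; ∃; _×_; _,_)
open import Data.Sum using (_⊎_)
open import Relation.Binary.PropositionalEquality using (_≡_)
open import Relation.Nullary using (¬_)

-- Node labels: ⊗ (true twin), ⊙ (false twin), ⊕ (attachment)
data Label : Set where
  ⊗ ⊙ ⊕ : Label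

data DTree : Set where
  leaf : DTree
  node : Label → DTree → DTree → DTree

-- Vertices of Ĝ(u): the leaves of the subtree rooted at u
-- (distinct leaves give distinct vertices).
data Vertex : DTree → Set where
  here  : Vertex leaf
  left  : ∀ {a l r} → Vertex l → Vertex (node a l r)
  right : ∀ {a l r} → Vertex r → Vertex (node a l r)

Subset : DTree → Set
Subset u = Vertex u → Bool

∣_∣ : ∀ {u} → Subset u → ℕ
∣_∣ {leaf} S = if S here then 1 else 0
∣_∣ {node a l r} S = ∣ (λ x → S (left x)) ∣ + ∣ (λ x → S (right x)) ∣

TS : (u : DTree) → Subset u
TS leaf here = true
TS (node ⊗ l r) (left x) = TS l x
TS (node ⊗ l r) (right x) = TS r x
TS (node ⊙ l r) (left x) = TS l x
TS (node ⊙ l r) (right x) = TS r x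
TS (node ⊕ l r) (left x) = TS l x
TS (node ⊕ l r) (right x) = false

-- edges between the two children created at a node with a given label
cross : Label → Bool → Bool → Bool
cross ⊗ a b = a ∧ b
cross ⊙ a b = false
cross ⊕ a b = a ∧ b

adj : (u : DTree) → Vertex u → Vertex u → Bool
adj leaf here here = false
adj (node a l r) (left x) (left y) = adj l x y
adj (node a l r) (right x) (right y) = adj r x y
adj (node a l r) (left x) (right y) = cross a (TS l x) (TS r y)
adj (node a l r) (right x) (left y) = cross a (TS l y) (TS r x)

InClosedNbhd : (u : DTree) → Subset u → Vertex u → Set
InClosedNbhd u S y = S y ≡ true ⊎ Σ (Vertex u) (λ x → S x ≡ true × T (adj u x y))

-- Ĝ(u)[W] has a perfect matching: a partner function pairing every vertex of W
-- with an adjacent vertex of W, involutively (M pairs = edges of the matching).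
HasPerfectMatching : (u : DTree) → Subset u → Set
HasPerfectMatching u W =
  Σ (Vertex u → Vertex u) λ M →
    ∀ y → W y ≡ true → W (M y) ≡ true × M (M y) ≡ y × T (adj u y (M y))

Admissible : (u : DTree) → ℕ → Subset u → Set
Admissible u k S =
  (∀ y → TS u y ≡ false → InClosedNbhd u S y) ×
  Σ (Subset u) λ X →
    (∀ y → X y ≡ true → S y ≡ true × TS u y ≡ true) ×
    ∣ X ∣ ≡ k ×
    HasPerfectMatching u (λ y → S y ∧ not (X y))

-- naturals extended with ∞ (minimum of the empty set)
data ℕ∞ : Set where
  fin : ℕ → ℕ∞
  ∞   : ℕ∞

_+∞_ : ℕ∞ → ℕ∞ → ℕ∞
fin m +∞ fin n = fin (m + n)
fin m +∞ ∞ = ∞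
∞ +∞ y = ∞

data _≤∞_ : ℕ∞ → ℕ∞ → Set where
  fin≤fin : ∀ {m n} → m ≤ n → fin m ≤∞ fin n
  _≤∞∞    : ∀ x → x ≤∞ ∞

IsMinℕ : (ℕ → Set) → ℕ∞ → Set
IsMinℕ P (fin n) = P n × (∀ m → P m → n ≤ m)
IsMinℕ P ∞ = ∀ m → ¬ P m

IsMin∞ : (ℕ∞ → Set) → ℕ∞ → Set
IsMin∞ Q x = Q x × (∀ y → Q y → x ≤∞ y)

-- γ̂_k(u) = x   (a functional relation: the minimum always exists and is unique)
γ̂ : (u : DTree) → ℕ → ℕ∞ → Set
γ̂ u k x = IsMinℕ (λ n → Σ (Subset u) λ S → Admissible u k S × ∣ S ∣ ≡ n) x

SumSet : DTree → DTree → ℕ∞ → Set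
SumSet l r y =
  Σ ℕ λ i → i ≤ ∣ TS l ∣ ⊓ ∣ TS r ∣ ×
    Σ ℕ∞ λ a → Σ ℕ∞ λ b → γ̂ l i a × γ̂ r i b × y ≡ a +∞ b

{-# OPTIONS --safe #-}
module Submission where

-- A perfect matching of Ĝ(v)[S] consists of edges inside Ĝ(v_l), edges inside Ĝ(v_r) and
-- crossing edges; since ⊗ joins exactly TŜ(v_l) to TŜ(v_r), the crossing edges pair off i
-- twins of v_l with i twins of v_r. Taking these as the sets X of γ̂_i splits S into admissible
-- sets for γ̂_i(v_l) and γ̂_i(v_r) (domination splits as well, crossing edges only touching
-- twins). Conversely admissible sets of the children with the same i glue to one for γ̂_0(v):
-- match their X's to each other by any bijection. As |S| is additive, γ̂_0(v) is the least of
-- the sums. It is finite because every Ĝ(u) has a set with a perfect matching dominating the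
-- non-twins, built bottom-up; at an ⊕ node this may need one extra edge between a twin of each
-- child, to dominate the twins of the right child.

open import Defs
open import Axiom.UniquenessOfIdentityProofs using (module Decidable⇒UIP)
open import Data.Bool using (Bool; true; false; _∧_; _∨_; not; T; if_then_else_)
import Data.Bool as Bool
open import Data.Bool.Properties
  using ( ¬-not; not-injective; T-≡; T-∧; ∨-zeroʳ; ∨-identityʳ; ∧-identityʳ; ∧-zeroʳ
        ; ∧-conicalˡ; ∧-conicalʳ)
open import Data.Empty using (⊥-elim)
open import Data.Fin using (Fin; zero)
open import Data.Fin.Permutation using (↔⇒≡)
open import Data.Fin.Properties using (¬Fin0; +↔⊎)
open import Data.Nat using (ℕ; zero; suc; _+_; _≤_; _⊓_; z≤n)
open import Data.Nat.Properties
  using (≤-refl; ≤-reflexive; ≤-trans; +-mono-≤; ⊓-glb; +-cancelˡ-≤; +-cancelʳ-≤)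
open import Data.Product using (Σ; ∃; _×_; _,_; proj₁; proj₂)
open import Data.Sum using (_⊎_; inj₁; inj₂)
open import Data.Sum.Function.Propositional using (_⊎-↔_)
open import Function using (_∘_; Inverse; Equivalence; _↔_; mk↔ₛ′)
open import Function.Properties.Inverse using (↔-sym; ↔-trans)
open import Relation.Binary.Definitions using (DecidableEquality)
open import Relation.Binary.PropositionalEquality
  using (_≡_; _≢_; refl; sym; trans; cong; cong₂; subst; module ≡-Reasoning)
open import Relation.Nullary using (contradiction; yes; no; does)
import Relation.Nullary.Decidable as Dec
open import Relation.Nullary.Decidable using (dec-true; dec-false)

Elem : ∀ {u} → Subset u → Set
Elem {u} X = Σ (Vertex u) λ y → X y ≡ true

elem-≡ : ∀ {u} {X : Subset u} {a b : Elem X} → proj₁ a ≡ proj₁ b → a ≡ b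
elem-≡ {a = y , p} {.y , q} refl = cong (y ,_) (Decidable⇒UIP.≡-irrelevant Bool._≟_ p q)

∅ : ∀ {u} → Subset u
∅ _ = false

_⊆_ : ∀ {u} → Subset u → Subset u → Set
X ⊆ Y = ∀ y → X y ≡ true → Y y ≡ true

_∪_ : ∀ {u} → Subset u → Subset u → Subset u
(X ∪ Y) y = X y ∨ Y y

_∖_ : ∀ {u} → Subset u → Subset u → Subset u
(X ∖ Y) y = X y ∧ not (Y y)

Disjoint : ∀ {u} → Subset u → Subset u → Set
Disjoint X Y = ∀ y → X y ≡ true → Y y ≡ false

join : ∀ {a l r} → Subset l → Subset r → Subset (node a l r)
join A B (left y) = A y
join A B (right z) = B z

∪-introˡ : ∀ {u} {X Y : Subset u} {y} → X y ≡ true → (X ∪ Y) y ≡ true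
∪-introˡ {Y = Y} {y} p = cong (_∨ Y y) p

∪-introʳ : ∀ {u} {X Y : Subset u} {y} → Y y ≡ true → (X ∪ Y) y ≡ true
∪-introʳ {X = X} {y = y} p = trans (cong (X y ∨_) p) (∨-zeroʳ (X y))

∖-elim : ∀ {u} {X Y : Subset u} {y} → (X ∖ Y) y ≡ true → X y ≡ true × Y y ≡ false
∖-elim {X = X} {Y} {y} p with X y | Y y
... | true | false = refl , refl

∖-intro : ∀ {u} {X Y : Subset u} {y} → X y ≡ true → Y y ≡ false → (X ∖ Y) y ≡ true
∖-intro p q rewrite p | q = refl

∖-disjoint : ∀ {u} {X Y : Subset u} → Disjoint (X ∖ Y) Y
∖-disjoint {X = X} {Y} y = proj₂ ∘ ∖-elim {X = X} {Y}

∖-empty⇒⊆ : ∀ {u} {X Y : Subset u} → (∀ y → (X ∖ Y) y ≡ false) → X ⊆ Y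
∖-empty⇒⊆ {X = X} {Y} X∖Y≡∅ y p with Y y in e
... | true = refl
... | false = contradiction (trans (sym (X∖Y≡∅ y)) (∖-intro {X = X} {Y} p e)) λ ()

⊆-∖-∪ : ∀ {u} {X Y : Subset u} → Y ⊆ X → ∀ y → X y ≡ ((X ∖ Y) ∪ Y) y
⊆-∖-∪ {X = X} {Y} Y⊆X y with Y y in e
... | true = trans (Y⊆X y e) (sym (∨-zeroʳ _))
... | false = sym (trans (∨-identityʳ _) (∧-identityʳ _))

join-disjoint : ∀ {a l r} {A C : Subset l} {B D : Subset r} →
  Disjoint A C → Disjoint B D → Disjoint (join {a} A B) (join C D)
join-disjoint A∩C≡∅ B∩D≡∅ (left y) = A∩C≡∅ y
join-disjoint A∩C≡∅ B∩D≡∅ (right z) = B∩D≡∅ z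

left-injective : ∀ {a l r} {x y : Vertex l} → left {a} {l} {r} x ≡ left y → x ≡ y
left-injective refl = refl

right-injective : ∀ {a l r} {x y : Vertex r} → right {a} {l} {r} x ≡ right y → x ≡ y
right-injective refl = refl

_≟ᵛ_ : ∀ {u} → DecidableEquality (Vertex u)
here ≟ᵛ here = yes refl
left x ≟ᵛ left y = Dec.map′ (cong left) left-injective (x ≟ᵛ y)
left x ≟ᵛ right y = no λ ()
right x ≟ᵛ left y = no λ ()
right x ≟ᵛ right y = Dec.map′ (cong right) right-injective (x ≟ᵛ y)

｛_｝ : ∀ {u} → Vertex u → Subset u
｛ t ｝ y = does (y ≟ᵛ t)

∈｛｝ : ∀ {u} (t : Vertex u) → ｛ t ｝ t ≡ true
∈｛｝ t = dec-true (t ≟ᵛ t) refl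

∈｛｝⇒≡ : ∀ {u} {t y : Vertex u} → ｛ t ｝ y ≡ true → y ≡ t
∈｛｝⇒≡ {t = t} {y} p with y ≟ᵛ t
... | yes y≡t = y≡t
... | no _ = contradiction p λ ()

｛｝⊆ : ∀ {u} {X : Subset u} {t} → X t ≡ true → ｛ t ｝ ⊆ X
｛｝⊆ {X = X} t∈X y y∈｛t｝ = subst (λ y → X y ≡ true) (sym (∈｛｝⇒≡ y∈｛t｝)) t∈X

∉⇒disjoint-｛｝ : ∀ {u} {X : Subset u} {t} → X t ≡ false → Disjoint X ｛ t ｝
∉⇒disjoint-｛｝ {X = X} {t} t∉X y y∈X =
  dec-false (y ≟ᵛ t) λ { refl → contradiction (trans (sym t∉X) y∈X) λ () }

some-twin : (u : DTree) → Elem (TS u)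
some-twin leaf = here , refl
some-twin (node ⊗ l r) = let t , p = some-twin l in left t , p
some-twin (node ⊙ l r) = let t , p = some-twin l in left t , p
some-twin (node ⊕ l r) = let t , p = some-twin l in left t , p

Elem-node↔ : ∀ {a l r} (X : Subset (node a l r)) → Elem X ↔ (Elem (X ∘ left) ⊎ Elem (X ∘ right))
Elem-node↔ X = mk↔ₛ′ split unsplit
  (λ { (inj₁ _) → refl ; (inj₂ _) → refl })
  (λ { (left _ , _) → refl ; (right _ , _) → refl })
  where
  split : Elem X → Elem (X ∘ left) ⊎ Elem (X ∘ right)
  split (left y , p) = inj₁ (y , p)
  split (right z , p) = inj₂ (z , p)
  unsplit : Elem (X ∘ left) ⊎ Elem (X ∘ right) → Elem X
  unsplit (inj₁ (y , p)) = left y , p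
  unsplit (inj₂ (z , p)) = right z , p

Elem↔Fin : ∀ {u} (X : Subset u) → Elem X ↔ Fin ∣ X ∣
Elem↔Fin {leaf} X with X here in e
... | true = mk↔ₛ′ (λ _ → zero) (λ _ → here , e)
  (λ { zero → refl }) (λ { (here , _) → elem-≡ refl })
... | false = mk↔ₛ′ (λ { (here , p) → contradiction (trans (sym e) p) λ () }) (λ ())
  (λ ()) (λ { (here , p) → contradiction (trans (sym e) p) λ () })
Elem↔Fin {node a l r} X =
  ↔-trans (Elem-node↔ X) (↔-trans (Elem↔Fin (X ∘ left) ⊎-↔ Elem↔Fin (X ∘ right)) (↔-sym +↔⊎))

∣∅∣≡0 : ∀ {u} → ∣ ∅ {u} ∣ ≡ 0
∣∅∣≡0 {leaf} = refl
∣∅∣≡0 {node a l r} = cong₂ _+_ (∣∅∣≡0 {l}) (∣∅∣≡0 {r})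

∣∣≡0⇒empty : ∀ {u} (X : Subset u) → ∣ X ∣ ≡ 0 → ∀ y → X y ≡ false
∣∣≡0⇒empty X ∣X∣≡0 y = ¬-not λ y∈X → ¬Fin0 (subst Fin ∣X∣≡0 (Inverse.to (Elem↔Fin X) (y , y∈X)))

witness? : ∀ {u} (X : Subset u) → Elem X ⊎ (∀ y → X y ≡ false)
witness? X with ∣ X ∣ in e
... | zero = inj₂ (∣∣≡0⇒empty X e)
... | suc _ = inj₁ (Inverse.from (Elem↔Fin X) (subst Fin (sym e) zero))

∣∣-mono : ∀ {u} {X Y : Subset u} → X ⊆ Y → ∣ X ∣ ≤ ∣ Y ∣
∣∣-mono {leaf} {X} {Y} X⊆Y with X here in e | Y here in e′
... | false | _ = z≤n
... | true | true = ≤-refl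
... | true | false = contradiction (trans (sym e′) (X⊆Y here e)) λ ()
∣∣-mono {node a l r} X⊆Y = +-mono-≤ (∣∣-mono (X⊆Y ∘ left)) (∣∣-mono (X⊆Y ∘ right))

record Bij {a b} (X : Subset a) (Y : Subset b) : Set where
  field
    to      : Vertex a → Vertex b
    from    : Vertex b → Vertex a
    to∈     : ∀ {y} → X y ≡ true → Y (to y) ≡ true
    from∈   : ∀ {z} → Y z ≡ true → X (from z) ≡ true
    from∘to : ∀ {y} → X y ≡ true → from (to y) ≡ y
    to∘from : ∀ {z} → Y z ≡ true → to (from z) ≡ z

Bij⇒↔ : ∀ {a b} {X : Subset a} {Y : Subset b} → Bij X Y → Elem X ↔ Elem Y
Bij⇒↔ B = mk↔ₛ′ (λ (y , p) → to y , to∈ p) (λ (z , q) → from z , from∈ q)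
  (λ (_ , q) → elem-≡ (to∘from q)) (λ (_ , p) → elem-≡ (from∘to p))
  where open Bij B

Bij⇒∣∣≡ : ∀ {a b} {X : Subset a} {Y : Subset b} → Bij X Y → ∣ X ∣ ≡ ∣ Y ∣
Bij⇒∣∣≡ {X = X} {Y} B = ↔⇒≡ (↔-trans (↔-sym (Elem↔Fin X)) (↔-trans (Bij⇒↔ B) (Elem↔Fin Y)))

module _ {a b} {X : Subset a} (f : Elem X → Vertex b) (default : Vertex b) where

  extendAt : (y : Vertex a) (x : Bool) → X y ≡ x → Vertex b
  extendAt y true  p = f (y , p)
  extendAt y false _ = default

  extend : Vertex a → Vertex b
  extend y = extendAt y (X y) refl

  extend-≡ : ∀ {y} (p : X y ≡ true) → extend y ≡ f (y , p)
  extend-≡ {y} p = go (X y) refl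
    where
    go : ∀ x (q : X y ≡ x) → extendAt y x q ≡ f (y , p)
    go true  q = cong f (elem-≡ refl)
    go false q = contradiction (trans (sym q) p) λ ()

↔⇒Bij : ∀ {a b} {X : Subset a} {Y : Subset b} → Elem X ↔ Elem Y → Bij X Y
↔⇒Bij {a} {b} {X} {Y} I = record
  { to = to ; from = from
  ; to∈ = λ p → subst (λ z → Y z ≡ true) (sym (to-≡ p)) (proj₂ (I.to (_ , p)))
  ; from∈ = λ q → subst (λ y → X y ≡ true) (sym (from-≡ q)) (proj₂ (I.from (_ , q)))
  ; from∘to = from∘to
  ; to∘from = to∘from }
  where
  module I = Inverse I
  open ≡-Reasoning

  to : Vertex a → Vertex b
  to = extend (proj₁ ∘ I.to) (proj₁ (some-twin b))
  from : Vertex b → Vertex a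
  from = extend (proj₁ ∘ I.from) (proj₁ (some-twin a))
  to-≡ : ∀ {y} (p : X y ≡ true) → to y ≡ proj₁ (I.to (y , p))
  to-≡ = extend-≡ (proj₁ ∘ I.to) (proj₁ (some-twin b))
  from-≡ : ∀ {z} (q : Y z ≡ true) → from z ≡ proj₁ (I.from (z , q))
  from-≡ = extend-≡ (proj₁ ∘ I.from) (proj₁ (some-twin a))

  from∘to : ∀ {y} → X y ≡ true → from (to y) ≡ y
  from∘to {y} p = begin
    from (to y)                   ≡⟨ cong from (to-≡ p) ⟩
    from (proj₁ (I.to (y , p)))   ≡⟨ from-≡ (proj₂ (I.to (y , p))) ⟩
    proj₁ (I.from (I.to (y , p))) ≡⟨ cong proj₁ (I.strictlyInverseʳ (y , p)) ⟩
    y                             ∎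
  to∘from : ∀ {z} → Y z ≡ true → to (from z) ≡ z
  to∘from {z} q = begin
    to (from z)                   ≡⟨ cong to (from-≡ q) ⟩
    to (proj₁ (I.from (z , q)))   ≡⟨ to-≡ (proj₂ (I.from (z , q))) ⟩
    proj₁ (I.to (I.from (z , q))) ≡⟨ cong proj₁ (I.strictlyInverseˡ (z , q)) ⟩
    z                             ∎

∣∣≡⇒Bij : ∀ {a b} {X : Subset a} {Y : Subset b} → ∣ X ∣ ≡ ∣ Y ∣ → Bij X Y
∣∣≡⇒Bij {X = X} {Y} ∣X∣≡∣Y∣ =
  ↔⇒Bij (↔-trans (subst (λ n → Elem X ↔ Fin n) ∣X∣≡∣Y∣ (Elem↔Fin X)) (↔-sym (Elem↔Fin Y)))

｛｝-Bij : ∀ {a b} (s : Vertex a) (t : Vertex b) → Bij ｛ s ｝ ｛ t ｝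
｛｝-Bij s t = record
  { to = λ _ → t ; from = λ _ → s
  ; to∈ = λ _ → ∈｛｝ t ; from∈ = λ _ → ∈｛｝ s
  ; from∘to = sym ∘ ∈｛｝⇒≡ ; to∘from = sym ∘ ∈｛｝⇒≡ }

-- Perfect matchings

Partner : (u : DTree) → Subset u → (Vertex u → Vertex u) → Vertex u → Vertex u → Set
Partner u W M y m = W m ≡ true × M m ≡ y × T (adj u y m)

-- HasPerfectMatching u W unfolds to Σ M (IsPerfectMatching u W M).
IsPerfectMatching : (u : DTree) → Subset u → (Vertex u → Vertex u) → Set
IsPerfectMatching u W M = ∀ y → W y ≡ true → Partner u W M y (M y)

pm-resp : ∀ {u} {A B : Subset u} {M} → (∀ y → A y ≡ B y) →
  IsPerfectMatching u A M → IsPerfectMatching u B M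
pm-resp A≗B pm y y∈B = let m∈ , mm , y~m = pm y (trans (A≗B y) y∈B) in
  trans (sym (A≗B _)) m∈ , mm , y~m

merge : ∀ {u} → Subset u → (Vertex u → Vertex u) → (Vertex u → Vertex u) → Vertex u → Vertex u
merge W M₁ M₂ y = if W y then M₂ y else M₁ y

∪-pm : ∀ {u} {A W : Subset u} {M₁ M₂} → Disjoint A W →
  IsPerfectMatching u A M₁ → IsPerfectMatching u W M₂ → IsPerfectMatching u (A ∪ W) (merge W M₁ M₂)
∪-pm {A = A} {W} {M₁} {M₂} A∩W≡∅ pm₁ pm₂ y y∈ with W y in e
... | true = let m∈ , mm , y~m = pm₂ y e in
  ∪-introʳ {X = A} {W} m∈ , trans (cong (if_then M₂ (M₂ y) else M₁ (M₂ y)) m∈) mm , y~m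
... | false = let m∈ , mm , y~m = pm₁ y (trans (sym (∨-identityʳ (A y))) y∈) in
  ∪-introˡ {X = A} {W} m∈ , trans (cong (if_then M₂ (M₁ y) else M₁ (M₁ y)) (A∩W≡∅ _ m∈)) mm , y~m

join-matching : ∀ {a l r} → (Vertex l → Vertex l) → (Vertex r → Vertex r) →
  Vertex (node a l r) → Vertex (node a l r)
join-matching Ml Mr (left y) = left (Ml y)
join-matching Ml Mr (right z) = right (Mr z)

join-pm : ∀ {a l r} {A B Ml Mr} → IsPerfectMatching l A Ml → IsPerfectMatching r B Mr →
  IsPerfectMatching (node a l r) (join A B) (join-matching Ml Mr)
join-pm pmˡ pmʳ (left y) y∈ = let m∈ , mm , y~m = pmˡ y y∈ in m∈ , cong left mm , y~m
join-pm pmˡ pmʳ (right z) z∈ = let m∈ , mm , z~m = pmʳ z z∈ in m∈ , cong right mm , z~m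

twins-adjacent : ∀ a {l r} (y : Vertex l) (z : Vertex r) → T (cross a true true) →
  TS l y ≡ true → TS r z ≡ true → T (cross a (TS l y) (TS r z))
twins-adjacent a y z c p q rewrite p | q = c

adjacent⇒twins : ∀ {l r} (y : Vertex l) (z : Vertex r) →
  T (adj (node ⊗ l r) (left y) (right z)) → TS l y ≡ true × TS r z ≡ true
adjacent⇒twins y z y~z =
  let p , q = Equivalence.to T-∧ y~z in Equivalence.to T-≡ p , Equivalence.to T-≡ q

cross-matching : ∀ {a l r} → (Vertex l → Vertex r) → (Vertex r → Vertex l) →
  Vertex (node a l r) → Vertex (node a l r)
cross-matching f g (left y) = right (f y)
cross-matching f g (right z) = left (g z)

cross-pm : ∀ {a l r} {X : Subset l} {Y : Subset r} → T (cross a true true) →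
  (B : Bij X Y) → X ⊆ TS l → Y ⊆ TS r →
  IsPerfectMatching (node a l r) (join X Y) (cross-matching (Bij.to B) (Bij.from B))
cross-pm {a} c B X⊆TS Y⊆TS (left y) y∈ =
  to∈ y∈ , cong left (from∘to y∈) , twins-adjacent a y (to y) c (X⊆TS _ y∈) (Y⊆TS _ (to∈ y∈))
  where open Bij B
cross-pm {a} c B X⊆TS Y⊆TS (right z) z∈ =
  from∈ z∈ , cong right (to∘from z∈) , twins-adjacent a (from z) z c (X⊆TS _ (from∈ z∈)) (Y⊆TS _ z∈)
  where open Bij B

-- Domination of the non-twins

DominatesNonTwins : (u : DTree) → Subset u → Set
DominatesNonTwins u S = ∀ y → TS u y ≡ false → InClosedNbhd u S y

nbhd-mono : ∀ {u} {A B : Subset u} {y} → A ⊆ B → InClosedNbhd u A y → InClosedNbhd u B y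
nbhd-mono A⊆B (inj₁ y∈) = inj₁ (A⊆B _ y∈)
nbhd-mono A⊆B (inj₂ (x , x∈ , x~y)) = inj₂ (x , A⊆B x x∈ , x~y)

nbhd-left : ∀ {a l r} {S : Subset (node a l r)} {y} →
  InClosedNbhd l (S ∘ left) y → InClosedNbhd (node a l r) S (left y)
nbhd-left (inj₁ y∈) = inj₁ y∈
nbhd-left (inj₂ (x , x∈ , x~y)) = inj₂ (left x , x∈ , x~y)

nbhd-right : ∀ {a l r} {S : Subset (node a l r)} {z} →
  InClosedNbhd r (S ∘ right) z → InClosedNbhd (node a l r) S (right z)
nbhd-right (inj₁ z∈) = inj₁ z∈
nbhd-right (inj₂ (x , x∈ , x~z)) = inj₂ (right x , x∈ , x~z)

dominates-mono : ∀ {u} {A B : Subset u} → A ⊆ B → DominatesNonTwins u A → DominatesNonTwins u B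
dominates-mono A⊆B dom y p = nbhd-mono A⊆B (dom y p)

dominates-join : ∀ a {l r} {S : Subset (node a l r)} → a ≢ ⊕ →
  DominatesNonTwins l (S ∘ left) → DominatesNonTwins r (S ∘ right) →
  DominatesNonTwins (node a l r) S
dominates-join ⊗ _ domˡ domʳ (left y) p = nbhd-left (domˡ y p)
dominates-join ⊗ _ domˡ domʳ (right z) p = nbhd-right (domʳ z p)
dominates-join ⊙ _ domˡ domʳ (left y) p = nbhd-left (domˡ y p)
dominates-join ⊙ _ domˡ domʳ (right z) p = nbhd-right (domʳ z p)
dominates-join ⊕ a≢⊕ = contradiction refl a≢⊕

dominates-⊕ : ∀ {l r} {S : Subset (node ⊕ l r)} →
  DominatesNonTwins l (S ∘ left) → DominatesNonTwins r (S ∘ right) →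
  (∃ λ t → TS l t ≡ true × S (left t) ≡ true) ⊎ TS r ⊆ (S ∘ right) →
  DominatesNonTwins (node ⊕ l r) S
dominates-⊕ domˡ domʳ _ (left y) p = nbhd-left (domˡ y p)
dominates-⊕ {r = r} domˡ domʳ twin∈S (right z) _ with TS r z in e | twin∈S
... | false | _ = nbhd-right (domʳ z e)
... | true | inj₁ (t , t-twin , t∈S) = inj₂ (left t , t∈S , twins-adjacent ⊕ t z _ t-twin e)
... | true | inj₂ TSʳ⊆S = inj₁ (TSʳ⊆S z e)

dominates-left : ∀ {l r} {S : Subset (node ⊗ l r)} →
  DominatesNonTwins (node ⊗ l r) S → DominatesNonTwins l (S ∘ left)
dominates-left dom y p with dom (left y) p
... | inj₁ y∈ = inj₁ y∈
... | inj₂ (left x , x∈ , x~y) = inj₂ (x , x∈ , x~y)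
... | inj₂ (right x , _ , x~y) = contradiction (trans (sym p) (proj₁ (adjacent⇒twins y x x~y))) λ ()

dominates-right : ∀ {l r} {S : Subset (node ⊗ l r)} →
  DominatesNonTwins (node ⊗ l r) S → DominatesNonTwins r (S ∘ right)
dominates-right dom z p with dom (right z) p
... | inj₁ z∈ = inj₁ z∈
... | inj₂ (right x , x∈ , x~z) = inj₂ (x , x∈ , x~z)
... | inj₂ (left x , _ , x~z) = contradiction (trans (sym p) (proj₂ (adjacent⇒twins x z x~z))) λ ()

-- Paired dominating sets

PairedDominating : (u : DTree) → Subset u → Set
PairedDominating u S = DominatesNonTwins u S × Σ (Vertex u → Vertex u) (IsPerfectMatching u S)

pd⇒admissible₀ : ∀ {u} {S : Subset u} → PairedDominating u S → Admissible u 0 S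
pd⇒admissible₀ {u} {S} (dom , M , pm) =
  dom , ∅ , (λ _ ()) , ∣∅∣≡0 {u} , M , pm-resp (λ y → sym (∧-identityʳ (S y))) pm

admissible₀⇒pd : ∀ {u} {S : Subset u} → Admissible u 0 S → PairedDominating u S
admissible₀⇒pd {S = S} (dom , X , _ , ∣X∣≡0 , M , pm) =
  dom , M , pm-resp X-empty pm
  where
  X-empty : ∀ y → (S ∖ X) y ≡ S y
  X-empty y = trans (cong (λ b → S y ∧ not b) (∣∣≡0⇒empty X ∣X∣≡0 y)) (∧-identityʳ (S y))

join-pd : ∀ a {l r} {A : Subset l} {B : Subset r} → a ≢ ⊕ →
  PairedDominating l A → PairedDominating r B → PairedDominating (node a l r) (join A B)
join-pd a a≢⊕ (domˡ , Mˡ , pmˡ) (domʳ , Mʳ , pmʳ) =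
  dominates-join a a≢⊕ domˡ domʳ , join-matching Mˡ Mʳ , join-pm pmˡ pmʳ

⊕-join-pd : ∀ {l r} {A : Subset l} {B : Subset r} → PairedDominating l A → PairedDominating r B →
  (∃ λ t → TS l t ≡ true × A t ≡ true) ⊎ TS r ⊆ B → PairedDominating (node ⊕ l r) (join A B)
⊕-join-pd (domˡ , Mˡ , pmˡ) (domʳ , Mʳ , pmʳ) twin∈ =
  dominates-⊕ domˡ domʳ twin∈ , join-matching Mˡ Mʳ , join-pm pmˡ pmʳ

⊕-pair-pd : ∀ {l r} {A : Subset l} {B : Subset r} {tˡ tʳ} →
  PairedDominating l A → PairedDominating r B →
  TS l tˡ ≡ true → A tˡ ≡ false → TS r tʳ ≡ true → B tʳ ≡ false →
  PairedDominating (node ⊕ l r) (join A B ∪ join ｛ tˡ ｝ ｛ tʳ ｝)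
⊕-pair-pd {l} {r} {A} {B} {tˡ} {tʳ} (domˡ , Mˡ , pmˡ) (domʳ , Mʳ , pmʳ) tˡ-twin tˡ∉A tʳ-twin tʳ∉B =
  dominates-⊕ (dominates-mono (λ _ → ∪-introˡ {X = A} {｛ tˡ ｝}) domˡ)
              (dominates-mono (λ _ → ∪-introˡ {X = B} {｛ tʳ ｝}) domʳ)
              (inj₁ (tˡ , tˡ-twin , ∪-introʳ {X = A} {｛ tˡ ｝} (∈｛｝ tˡ))) ,
  merge (join ｛ tˡ ｝ ｛ tʳ ｝) (join-matching Mˡ Mʳ) (cross-matching (λ _ → tʳ) (λ _ → tˡ)) ,
  ∪-pm (join-disjoint (∉⇒disjoint-｛｝ {X = A} tˡ∉A) (∉⇒disjoint-｛｝ {X = B} tʳ∉B)) (join-pm pmˡ pmʳ)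
    (cross-pm _ (｛｝-Bij tˡ tʳ) (｛｝⊆ {X = TS l} tˡ-twin) (｛｝⊆ {X = TS r} tʳ-twin))

⊕-pd : ∀ {l r} {A : Subset l} {B : Subset r} → PairedDominating l A → PairedDominating r B →
  Σ (Subset (node ⊕ l r)) (PairedDominating (node ⊕ l r))
⊕-pd {l} {r} {A} {B} pdˡ pdʳ with witness? (TS r ∖ B) | witness? (TS l ∖ A)
... | inj₂ TSʳ∖B≡∅ | _ = _ , ⊕-join-pd pdˡ pdʳ (inj₂ (∖-empty⇒⊆ {X = TS r} {B} TSʳ∖B≡∅))
... | inj₁ _ | inj₂ TSˡ∖A≡∅ =
  let t , t-twin = some-twin l in
  _ , ⊕-join-pd pdˡ pdʳ (inj₁ (t , t-twin , ∖-empty⇒⊆ {X = TS l} {A} TSˡ∖A≡∅ t t-twin))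
... | inj₁ (tʳ , tʳ∈) | inj₁ (tˡ , tˡ∈) =
  let tˡ-twin , tˡ∉A = ∖-elim {X = TS l} {A} tˡ∈
      tʳ-twin , tʳ∉B = ∖-elim {X = TS r} {B} tʳ∈
  in _ , ⊕-pair-pd pdˡ pdʳ tˡ-twin tˡ∉A tʳ-twin tʳ∉B

pd-exists : (u : DTree) → Σ (Subset u) (PairedDominating u)
pd-exists leaf = ∅ , (λ { here () }) , (λ y → y) , (λ _ ())
pd-exists (node ⊗ l r) = _ , join-pd ⊗ (λ ()) (proj₂ (pd-exists l)) (proj₂ (pd-exists r))
pd-exists (node ⊙ l r) = _ , join-pd ⊙ (λ ()) (proj₂ (pd-exists l)) (proj₂ (pd-exists r))
pd-exists (node ⊕ l r) = ⊕-pd (proj₂ (pd-exists l)) (proj₂ (pd-exists r))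

-- Splitting and joining at a ⊗ node

isRight : ∀ {a l r} → Vertex (node a l r) → Bool
isRight (left _) = false
isRight (right _) = true

fromLeft : ∀ {a l r} → Vertex l → Vertex (node a l r) → Vertex l
fromLeft _ (left y) = y
fromLeft d (right _) = d

fromRight : ∀ {a l r} → Vertex r → Vertex (node a l r) → Vertex r
fromRight d (left _) = d
fromRight _ (right z) = z

isRight≡false⇒left : ∀ {a l r} {m : Vertex (node a l r)} d →
  isRight m ≡ false → m ≡ left (fromLeft d m)
isRight≡false⇒left {m = left _} _ _ = refl

isRight≡true⇒right : ∀ {a l r} {m : Vertex (node a l r)} d →
  isRight m ≡ true → m ≡ right (fromRight d m)
isRight≡true⇒right {m = right _} _ _ = refl

module Split {l r} {S : Subset (node ⊗ l r)} (dom : DominatesNonTwins (node ⊗ l r) S)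
             {M} (pm : IsPerfectMatching (node ⊗ l r) S M) where

  crossingˡ : Subset l
  crossingˡ y = S (left y) ∧ isRight (M (left y))

  crossingʳ : Subset r
  crossingʳ z = S (right z) ∧ not (isRight (M (right z)))

  partnerʳ : Vertex l → Vertex r
  partnerʳ y = fromRight (proj₁ (some-twin r)) (M (left y))

  partnerˡ : Vertex r → Vertex l
  partnerˡ z = fromLeft (proj₁ (some-twin l)) (M (right z))

  Mˡ : Vertex l → Vertex l
  Mˡ y = fromLeft y (M (left y))

  Mʳ : Vertex r → Vertex r
  Mʳ z = fromRight z (M (right z))

  partner-at : ∀ {y m} → S y ≡ true → M y ≡ m → Partner (node ⊗ l r) S M y m
  partner-at {y} y∈ M·y≡m = subst (Partner (node ⊗ l r) S M y) M·y≡m (pm y y∈)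

  crossingˡ-partner : ∀ {y} → crossingˡ y ≡ true →
    Partner (node ⊗ l r) S M (left y) (right (partnerʳ y))
  crossingˡ-partner p = partner-at (∧-conicalˡ _ _ p) (isRight≡true⇒right _ (∧-conicalʳ _ _ p))

  crossingʳ-partner : ∀ {z} → crossingʳ z ≡ true →
    Partner (node ⊗ l r) S M (right z) (left (partnerˡ z))
  crossingʳ-partner p =
    partner-at (∧-conicalˡ _ _ p) (isRight≡false⇒left _ (not-injective (∧-conicalʳ _ _ p)))

  crossing-Bij : Bij crossingˡ crossingʳ
  crossing-Bij = record
    { to = partnerʳ ; from = partnerˡ
    ; to∈ = λ p → let m∈ , mm , _ = crossingˡ-partner p in cong₂ _∧_ m∈ (cong (not ∘ isRight) mm)
    ; from∈ = λ p → let m∈ , mm , _ = crossingʳ-partner p in cong₂ _∧_ m∈ (cong isRight mm)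
    ; from∘to = λ p → cong (fromLeft _) (proj₁ (proj₂ (crossingˡ-partner p)))
    ; to∘from = λ p → cong (fromRight _) (proj₁ (proj₂ (crossingʳ-partner p))) }

  crossingˡ⊆TS : crossingˡ ⊆ TS l
  crossingˡ⊆TS y p = proj₁ (adjacent⇒twins y (partnerʳ y) (proj₂ (proj₂ (crossingˡ-partner p))))

  crossingʳ⊆TS : crossingʳ ⊆ TS r
  crossingʳ⊆TS z p = proj₂ (adjacent⇒twins (partnerˡ z) z (proj₂ (proj₂ (crossingʳ-partner p))))

  stays-left : ∀ {y} → S (left y) ≡ true → crossingˡ y ≡ false → M (left y) ≡ left (Mˡ y)
  stays-left y∈ ¬cross = isRight≡false⇒left _ (trans (sym (cong (_∧ _) y∈)) ¬cross)

  stays-right : ∀ {z} → S (right z) ≡ true → crossingʳ z ≡ false → M (right z) ≡ right (Mʳ z)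
  stays-right z∈ ¬cross = isRight≡true⇒right _ (not-injective (trans (sym (cong (_∧ _) z∈)) ¬cross))

  pmˡ : IsPerfectMatching l ((S ∘ left) ∖ crossingˡ) Mˡ
  pmˡ y y∈ =
    let s , ¬cross = ∖-elim {X = S ∘ left} {crossingˡ} y∈
        m∈ , mm , y~m = partner-at s (stays-left s ¬cross)
    in ∖-intro {X = S ∘ left} {crossingˡ} m∈
         (trans (cong (λ m → S (left (Mˡ y)) ∧ isRight m) mm) (∧-zeroʳ _)) ,
       cong (fromLeft _) mm , y~m

  pmʳ : IsPerfectMatching r ((S ∘ right) ∖ crossingʳ) Mʳ
  pmʳ z z∈ =
    let s , ¬cross = ∖-elim {X = S ∘ right} {crossingʳ} z∈
        m∈ , mm , z~m = partner-at s (stays-right s ¬cross)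
    in ∖-intro {X = S ∘ right} {crossingʳ} m∈
         (trans (cong (λ m → S (right (Mʳ z)) ∧ not (isRight m)) mm) (∧-zeroʳ _)) ,
       cong (fromRight _) mm , z~m

  crossing : ℕ
  crossing = ∣ crossingˡ ∣

  admissibleˡ : Admissible l crossing (S ∘ left)
  admissibleˡ =
    dominates-left dom , crossingˡ , (λ y p → ∧-conicalˡ _ _ p , crossingˡ⊆TS y p) , refl , Mˡ , pmˡ

  admissibleʳ : Admissible r crossing (S ∘ right)
  admissibleʳ =
    dominates-right dom , crossingʳ , (λ z p → ∧-conicalˡ _ _ p , crossingʳ⊆TS z p) ,
    sym (Bij⇒∣∣≡ crossing-Bij) , Mʳ , pmʳ

  crossing≤ : crossing ≤ ∣ TS l ∣ ⊓ ∣ TS r ∣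
  crossing≤ =
    ⊓-glb (∣∣-mono crossingˡ⊆TS)
          (≤-trans (≤-reflexive (Bij⇒∣∣≡ crossing-Bij)) (∣∣-mono crossingʳ⊆TS))

join-admissible : ∀ {l r i} {A : Subset l} {B : Subset r} →
  Admissible l i A → Admissible r i B → Admissible (node ⊗ l r) 0 (join A B)
join-admissible {A = A} {B} (domˡ , X , X⊆ , ∣X∣≡i , Mˡ , pmˡ) (domʳ , Y , Y⊆ , ∣Y∣≡i , Mʳ , pmʳ) =
  pd⇒admissible₀
    ( dominates-join ⊗ (λ ()) domˡ domʳ
    , merge (join X Y) (join-matching Mˡ Mʳ) (cross-matching (Bij.to X≅Y) (Bij.from X≅Y))
    , pm-resp split
        (∪-pm (join-disjoint (∖-disjoint {X = A} {X}) (∖-disjoint {X = B} {Y})) (join-pm pmˡ pmʳ)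
              (cross-pm _ X≅Y (λ y → proj₂ ∘ X⊆ y) (λ z → proj₂ ∘ Y⊆ z))))
  where
  X≅Y : Bij X Y
  X≅Y = ∣∣≡⇒Bij (trans ∣X∣≡i (sym ∣Y∣≡i))
  split : ∀ y → (join (A ∖ X) (B ∖ Y) ∪ join X Y) y ≡ join {⊗} A B y
  split (left y) = sym (⊆-∖-∪ (λ y → proj₁ ∘ X⊆ y) y)
  split (right z) = sym (⊆-∖-∪ (λ z → proj₁ ∘ Y⊆ z) z)

γ̂-minimal : ∀ {u k n} {S : Subset u} → γ̂ u k (fin n) → Admissible u k S → n ≤ ∣ S ∣
γ̂-minimal (_ , minimal) adm = minimal _ (_ , adm , refl)

γ̂-bound : ∀ {u k x} {S : Subset u} → γ̂ u k x → Admissible u k S → x ≤∞ fin ∣ S ∣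
γ̂-bound {x = fin _} γ adm = fin≤fin (γ̂-minimal γ adm)
γ̂-bound {x = ∞} none adm = ⊥-elim (none _ (_ , adm , refl))

γ̂-intro : ∀ {u k} {S : Subset u} → Admissible u k S →
  (∀ {S′} → Admissible u k S′ → ∣ S ∣ ≤ ∣ S′ ∣) → γ̂ u k (fin ∣ S ∣)
γ̂-intro adm minimal = (_ , adm , refl) , λ { _ (_ , adm′ , refl) → minimal adm′ }

γ̂-⊗-≤ : ∀ {l r i x a b} → γ̂ (node ⊗ l r) 0 x → γ̂ l i a → γ̂ r i b → x ≤∞ (a +∞ b)
γ̂-⊗-≤ {a = ∞} _ _ _ = _ ≤∞∞
γ̂-⊗-≤ {a = fin _} {∞} _ _ _ = _ ≤∞∞
γ̂-⊗-≤ {a = fin _} {fin _} γ ((_ , admˡ , refl) , _) ((_ , admʳ , refl) , _) =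
  γ̂-bound γ (join-admissible admˡ admʳ)

γ̂-⊗-attained : ∀ {l r x} → γ̂ (node ⊗ l r) 0 x → SumSet l r x
γ̂-⊗-attained {l} {r} {∞} none =
  let _ , pd = pd-exists (node ⊗ l r) in ⊥-elim (none _ (_ , pd⇒admissible₀ pd , refl))
γ̂-⊗-attained {l} {r} {fin _} γ@((S , adm , refl) , _) with admissible₀⇒pd adm
... | dom , _ , pm =
  crossing , crossing≤ , fin ∣ S ∘ left ∣ , fin ∣ S ∘ right ∣ ,
  γ̂-intro admissibleˡ minimalˡ , γ̂-intro admissibleʳ minimalʳ , refl
  where
  open Split dom pm
  minimalˡ : ∀ {A} → Admissible l crossing A → ∣ S ∘ left ∣ ≤ ∣ A ∣
  minimalˡ admˡ = +-cancelʳ-≤ ∣ S ∘ right ∣ _ _ (γ̂-minimal γ (join-admissible admˡ admissibleʳ))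
  minimalʳ : ∀ {B} → Admissible r crossing B → ∣ S ∘ right ∣ ≤ ∣ B ∣
  minimalʳ admʳ = +-cancelˡ-≤ ∣ S ∘ left ∣ _ _ (γ̂-minimal γ (join-admissible admissibleˡ admʳ))

lemma11 : (l r : DTree) (x : ℕ∞) →
    γ̂ (node ⊗ l r) 0 x → IsMin∞ (SumSet l r) x
lemma11 l r x γ = γ̂-⊗-attained γ , λ { _ (_ , _ , _ , _ , γˡ , γʳ , refl) → γ̂-⊗-≤ γ γˡ γʳ }
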